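{- For nonnegative integers $m,n$ and any number $\alpha\neq 0$, \[ \sum_{a=1}^{m}\sum_{b=1}^{n}\binom{(1+\alpha)m-a+b-1}{m-a}\binom{(1+\alpha^{ -1})n+a-b-1}{n-b} =\frac{mn}{(1+\alpha)(m+\alpha^{ -1}n)}\binom{(1+\alpha)m}{m}\binom{(1+\alpha^{ -1})n}{n}. \]
   Context: For an arbitrary (complex) number $z$ and an integer $k$, the binomial coefficient is $\binom{z}{k}=\frac{z(z-1)\cdots(z-k+1)}{k!}$ for $k\ge 0$ and $\binom{z}{k}=0$ for $k<0$. An empty sum is $0$. -}

module Defs where

open import Level using (Level; suc; _⊔_)
open import Algebra.Bundles using (CommutativeRing)
open import Data.Nat.Base as ℕ using (ℕ; zero; NonZero; _!)
open import Data.Nat.Properties using (_!≢0)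
open import Relation.Nullary using (¬_)

ι : ∀ {c ℓ} (R : CommutativeRing c ℓ) → ℕ → CommutativeRing.Carrier R
ι R zero = CommutativeRing.0# R
ι R (ℕ.suc n) = CommutativeRing._+_ R (ι R n) (CommutativeRing.1# R)

record CharZeroField c ℓ : Set (suc (c ⊔ ℓ)) where
  field
    commutativeRing : CommutativeRing c ℓ
  open CommutativeRing commutativeRing public
  field
    nontrivial : ¬ (1# ≈ 0#)
    inv        : (x : Carrier) → ¬ (x ≈ 0#) → Carrier
    inverse    : ∀ x (p : ¬ (x ≈ 0#)) → (x * inv x p) ≈ 1#
    charZero   : ∀ n → NonZero n → ¬ (ι commutativeRing n ≈ 0#)

  ⟦_⟧ : ℕ → Carrier
  ⟦ n ⟧ = ι commutativeRing n

  falling : Carrier → ℕ → Carrier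
  falling z zero = 1#
  falling z (ℕ.suc k) = falling z k * (z - ⟦ k ⟧)

  binom : Carrier → ℕ → Carrier
  binom z k = falling z k * inv ⟦ k ! ⟧ (charZero (k !) (k !≢0))

  Σ₁ : ℕ → (ℕ → Carrier) → Carrier
  Σ₁ zero f = 0#
  Σ₁ (ℕ.suc m) f = Σ₁ m f + f (ℕ.suc m)

{-# OPTIONS --safe #-}
module Submission where

-- For arbitrary x, y let S(m,n) be the double sum with (1+α)m, (1+α⁻¹)n replaced by x, y, and
-- D(m,n) = Σ_{k ≥ 1} C(x, m-k) C(y, n-k).  Apart from its first row and column, S(m+1,n+1) is
-- S(m,n) re-indexed; that row and column are Vandermonde-type convolutions, equal to
-- D(m+1,n+1) and D(m,n+1) with x replaced by x - 1, and Pascal's rule adds them up to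
-- D(m+1,n+1).  So S(m+1,n+1) = S(m,n) + D(m+1,n+1), and induction along the diagonal with the
-- absorption identity (k+1) C(z,k+1) = (z-k) C(z,k) yields
--   (x + y) S(m,n) = mn C(x,m) C(y,n) - (xy - nx - my) D(m,n).
-- For x = (1+α)m and y = (1+α⁻¹)n one has x + y = (1+α)(m + α⁻¹n) and xy = nx + my.

open import Defs
open import Data.Nat.Base as ℕ using (ℕ; zero; suc; _∸_; _!)
open import Relation.Nullary using (¬_; dec⇒maybe)
open import Algebra.Bundles using (CommutativeRing)
open import Algebra.Solver.Ring.AlmostCommutativeRing using (fromCommutativeRing; _-Raw-AlmostCommutative⟶_)
open import Data.Integer.Base as ℤ using (ℤ; +_; -[1+_]; _⊖_)
import Data.Integer.Properties as ℤ
import Data.Nat.Properties as ℕ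
open import Data.Maybe.Base using (Maybe; map)
import Relation.Binary.PropositionalEquality as ≡

-- ℤ serves as coefficient ring of the ring solver over an arbitrary commutative ring.  fromℤ is
-- built on the optimised n × 1#, for which 1 × 1# reduces to 1#: the equations produced by solve
-- then match goals written with 1#.
module IntegerSolver {c ℓ} (R : CommutativeRing c ℓ) where
  open CommutativeRing R
  open import Algebra.Properties.Ring ring using (-‿involutive; -0#≈0#; -‿distribˡ-*; -‿+-comm)
  open import Algebra.Properties.CommutativeSemigroup +-commutativeSemigroup using (interchange)
  open import Algebra.Properties.Semiring.Mult.TCOptimised semiring using (_×_; 1+×; ×-homo-+; ×1-homo-*)
  open import Relation.Binary.Reasoning.Setoid setoid
  import Algebra.Solver.Ring

  ι≈×1 : ∀ n → ι R n ≈ n × 1#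
  ι≈×1 zero = refl
  ι≈×1 (suc zero) = +-identityˡ 1#
  ι≈×1 (suc (suc n)) = +-congʳ (ι≈×1 (suc n))

  ι-homo-* : ∀ m n → ι R (m ℕ.* n) ≈ ι R m * ι R n
  ι-homo-* m n = begin
    ι R (m ℕ.* n)       ≈⟨ ι≈×1 (m ℕ.* n) ⟩
    (m ℕ.* n) × 1#      ≈⟨ ×1-homo-* m n ⟩
    (m × 1#) * (n × 1#) ≈⟨ *-cong (ι≈×1 m) (ι≈×1 n) ⟨
    ι R m * ι R n       ∎

  fromℤ : ℤ → Carrier
  fromℤ (+ n) = n × 1#
  fromℤ -[1+ n ] = - (suc n × 1#)

  fromℤ-⊖ : ∀ m n → fromℤ (m ⊖ n) ≈ m × 1# - n × 1#
  fromℤ-⊖ zero zero = sym (-‿inverseʳ 0#)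
  fromℤ-⊖ zero (suc n) = sym (+-identityˡ _)
  fromℤ-⊖ (suc m) zero = sym (trans (+-congˡ -0#≈0#) (+-identityʳ _))
  fromℤ-⊖ (suc m) (suc n) = begin
    fromℤ (suc m ⊖ suc n)                    ≡⟨ ≡.cong fromℤ (ℤ.[1+m]⊖[1+n]≡m⊖n m n) ⟩
    fromℤ (m ⊖ n)                            ≈⟨ fromℤ-⊖ m n ⟩
    m × 1# - n × 1#                          ≈⟨ +-identityˡ _ ⟨
    0# + (m × 1# - n × 1#)                   ≈⟨ +-congʳ (-‿inverseʳ 1#) ⟨
    (1# - 1#) + (m × 1# - n × 1#)            ≈⟨ interchange 1# (- 1#) (m × 1#) (- (n × 1#)) ⟩
    (1# + m × 1#) + (- 1# + - (n × 1#))      ≈⟨ +-congˡ (-‿+-comm 1# (n × 1#)) ⟩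
    (1# + m × 1#) - (1# + n × 1#)            ≈⟨ +-cong (1+× m 1#) (-‿cong (1+× n 1#)) ⟨
    suc m × 1# - suc n × 1#                  ∎

  fromℤ-+ : ∀ i j → fromℤ (i ℤ.+ j) ≈ fromℤ i + fromℤ j
  fromℤ-+ (+ m) (+ n) = ×-homo-+ 1# m n
  fromℤ-+ (+ m) -[1+ n ] = fromℤ-⊖ m (suc n)
  fromℤ-+ -[1+ m ] (+ n) = trans (fromℤ-⊖ n (suc m)) (+-comm _ _)
  fromℤ-+ -[1+ m ] -[1+ n ] = begin
    - (suc (suc (m ℕ.+ n)) × 1#)        ≡⟨ ≡.cong (λ k → - (suc k × 1#)) (ℕ.+-suc m n) ⟨
    - ((suc m ℕ.+ suc n) × 1#)          ≈⟨ -‿cong (×-homo-+ 1# (suc m) (suc n)) ⟩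
    - (suc m × 1# + suc n × 1#)         ≈⟨ -‿+-comm _ _ ⟨
    - (suc m × 1#) + - (suc n × 1#)     ∎

  fromℤ-neg : ∀ i → fromℤ (ℤ.- i) ≈ - fromℤ i
  fromℤ-neg (+ zero) = sym -0#≈0#
  fromℤ-neg (+ suc n) = refl
  fromℤ-neg -[1+ n ] = sym (-‿involutive _)

  fromℤ-[+m]* : ∀ m j → fromℤ (+ m ℤ.* j) ≈ m × 1# * fromℤ j
  fromℤ-[+m]* zero j = sym (zeroˡ _)
  fromℤ-[+m]* (suc m) j = begin
    fromℤ (+ suc m ℤ.* j)             ≡⟨ ≡.cong fromℤ (ℤ.suc-* (+ m) j) ⟩
    fromℤ (j ℤ.+ + m ℤ.* j)           ≈⟨ fromℤ-+ j (+ m ℤ.* j) ⟩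
    fromℤ j + fromℤ (+ m ℤ.* j)       ≈⟨ +-cong (sym (*-identityˡ _)) (fromℤ-[+m]* m j) ⟩
    1# * fromℤ j + m × 1# * fromℤ j   ≈⟨ distribʳ _ _ _ ⟨
    (1# + m × 1#) * fromℤ j           ≈⟨ *-congʳ (1+× m 1#) ⟨
    suc m × 1# * fromℤ j              ∎

  fromℤ-* : ∀ i j → fromℤ (i ℤ.* j) ≈ fromℤ i * fromℤ j
  fromℤ-* (+ m) j = fromℤ-[+m]* m j
  fromℤ-* -[1+ m ] j = begin
    fromℤ (-[1+ m ] ℤ.* j)            ≡⟨ ≡.cong fromℤ (ℤ.neg-distribˡ-* (+ suc m) j) ⟨
    fromℤ (ℤ.- (+ suc m ℤ.* j))       ≈⟨ fromℤ-neg (+ suc m ℤ.* j) ⟩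
    - fromℤ (+ suc m ℤ.* j)           ≈⟨ -‿cong (fromℤ-[+m]* (suc m) j) ⟩
    - (suc m × 1# * fromℤ j)          ≈⟨ -‿distribˡ-* _ _ ⟩
    - (suc m × 1#) * fromℤ j          ∎

  fromℤ-homomorphism : ℤ.+-*-rawRing -Raw-AlmostCommutative⟶ fromCommutativeRing R
  fromℤ-homomorphism = record
    { ⟦_⟧ = fromℤ
    ; +-homo = fromℤ-+
    ; *-homo = fromℤ-*
    ; -‿homo = fromℤ-neg
    ; 0-homo = refl
    ; 1-homo = refl
    }

  fromℤ-≟ : ∀ i j → Maybe (fromℤ i ≈ fromℤ j)
  fromℤ-≟ i j = map (λ i≡j → reflexive (≡.cong fromℤ i≡j)) (dec⇒maybe (i ℤ.≟ j))

  private module Solver = Algebra.Solver.Ring ℤ.+-*-rawRing (fromCommutativeRing R) fromℤ-homomorphism fromℤ-≟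
  open Solver public using (Polynomial; solve; _:=_; _:+_; _:*_; _:-_)

  𝟘 𝟙 : ∀ {n} → Polynomial n
  𝟘 = Solver.con (+ 0)
  𝟙 = Solver.con (+ 1)

module Development {c ℓ} (F : CharZeroField c ℓ) where
  open CharZeroField F
  open IntegerSolver commutativeRing
  open import Relation.Binary.Reasoning.Setoid setoid

  x*y≈z⇒y≈x⁻¹*z : ∀ {x y z} (x≉0 : ¬ x ≈ 0#) → x * y ≈ z → y ≈ inv x x≉0 * z
  x*y≈z⇒y≈x⁻¹*z {x} {y} {z} x≉0 xy≈z = begin
    y                    ≈⟨ *-identityˡ y ⟨
    1# * y               ≈⟨ *-congʳ (trans (*-comm _ _) (inverse x x≉0)) ⟨
    (inv x x≉0 * x) * y  ≈⟨ *-assoc _ _ _ ⟩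
    inv x x≉0 * (x * y)  ≈⟨ *-congˡ xy≈z ⟩
    inv x x≉0 * z        ∎

  invFact : ℕ → Carrier
  invFact k = inv ⟦ k ! ⟧ (charZero (k !) (k ℕ.!≢0))

  ⟦suc⟧*invFact-suc : ∀ k → ⟦ suc k ⟧ * invFact (suc k) ≈ invFact k
  ⟦suc⟧*invFact-suc k = trans (x*y≈z⇒y≈x⁻¹*z (charZero (k !) (k ℕ.!≢0)) k!*[1+k]/[1+k]!≈1) (*-identityʳ _)
    where
    k!*[1+k]/[1+k]!≈1 : ⟦ k ! ⟧ * (⟦ suc k ⟧ * invFact (suc k)) ≈ 1#
    k!*[1+k]/[1+k]!≈1 = begin
      ⟦ k ! ⟧ * (⟦ suc k ⟧ * invFact (suc k))
        ≈⟨ solve 3 (λ f s i → f :* (s :* i) := (s :* f) :* i) refl ⟦ k ! ⟧ ⟦ suc k ⟧ (invFact (suc k)) ⟩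
      (⟦ suc k ⟧ * ⟦ k ! ⟧) * invFact (suc k)
        ≈⟨ *-congʳ (ι-homo-* (suc k) (k !)) ⟨
      ⟦ suc k ! ⟧ * invFact (suc k)
        ≈⟨ inverse _ _ ⟩
      1# ∎

  falling-cong : ∀ {z z′} k → z ≈ z′ → falling z k ≈ falling z′ k
  falling-cong zero z≈z′ = refl
  falling-cong (suc k) z≈z′ = *-cong (falling-cong k z≈z′) (+-congʳ z≈z′)

  binom-cong : ∀ {z z′} k → z ≈ z′ → binom z k ≈ binom z′ k
  binom-cong k z≈z′ = *-congʳ (falling-cong k z≈z′)

  binom²-cong : ∀ {z z′ w w′} k l → z ≈ z′ → w ≈ w′ → binom z k * binom w l ≈ binom z′ k * binom w′ l
  binom²-cong k l z≈z′ w≈w′ = *-cong (binom-cong k z≈z′) (binom-cong l w≈w′)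

  falling-shift : ∀ z k → falling (z + 1#) (suc k) ≈ (z + 1#) * falling z k
  falling-shift z zero = solve 1 (λ z → 𝟙 :* (z :+ 𝟙 :- 𝟘) := (z :+ 𝟙) :* 𝟙) refl z
  falling-shift z (suc k) = begin
    falling (z + 1#) (suc k) * (z + 1# - (⟦ k ⟧ + 1#))
      ≈⟨ *-congʳ (falling-shift z k) ⟩
    (z + 1#) * falling z k * (z + 1# - (⟦ k ⟧ + 1#))
      ≈⟨ solve 3 (λ z f k → (z :+ 𝟙) :* f :* (z :+ 𝟙 :- (k :+ 𝟙)) := (z :+ 𝟙) :* (f :* (z :- k)))
           refl z (falling z k) ⟦ k ⟧ ⟩
    (z + 1#) * (falling z k * (z - ⟦ k ⟧)) ∎

  binom-absorption : ∀ z k → ⟦ suc k ⟧ * binom z (suc k) ≈ (z - ⟦ k ⟧) * binom z k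
  binom-absorption z k = begin
    ⟦ suc k ⟧ * (falling z k * (z - ⟦ k ⟧) * invFact (suc k))
      ≈⟨ solve 4 (λ s f w i → s :* (f :* w :* i) := w :* (f :* (s :* i)))
           refl ⟦ suc k ⟧ (falling z k) (z - ⟦ k ⟧) (invFact (suc k)) ⟩
    (z - ⟦ k ⟧) * (falling z k * (⟦ suc k ⟧ * invFact (suc k)))
      ≈⟨ *-congˡ (*-congˡ (⟦suc⟧*invFact-suc k)) ⟩
    (z - ⟦ k ⟧) * binom z k ∎

  binom-pascal : ∀ z k → binom (z + 1#) (suc k) ≈ binom z (suc k) + binom z k
  binom-pascal z k = begin
    falling (z + 1#) (suc k) * invFact (suc k)
      ≈⟨ *-congʳ (falling-shift z k) ⟩
    (z + 1#) * falling z k * invFact (suc k)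
      ≈⟨ solve 4 (λ z f k i → (z :+ 𝟙) :* f :* i := f :* (z :- k) :* i :+ f :* ((k :+ 𝟙) :* i))
           refl z (falling z k) ⟦ k ⟧ (invFact (suc k)) ⟩
    binom z (suc k) + falling z k * (⟦ suc k ⟧ * invFact (suc k))
      ≈⟨ +-congˡ (*-congˡ (⟦suc⟧*invFact-suc k)) ⟩
    binom z (suc k) + binom z k ∎

  Σ₁-cong : ∀ m {f g : ℕ → Carrier} → (∀ a → f a ≈ g a) → Σ₁ m f ≈ Σ₁ m g
  Σ₁-cong zero f≈g = refl
  Σ₁-cong (suc m) f≈g = +-cong (Σ₁-cong m f≈g) (f≈g (suc m))

  Σ₁-zero : ∀ m → Σ₁ m (λ _ → 0#) ≈ 0#
  Σ₁-zero zero = refl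
  Σ₁-zero (suc m) = trans (+-identityʳ _) (Σ₁-zero m)

  Σ₁-+ : ∀ m (f g : ℕ → Carrier) → Σ₁ m (λ a → f a + g a) ≈ Σ₁ m f + Σ₁ m g
  Σ₁-+ zero f g = sym (+-identityˡ 0#)
  Σ₁-+ (suc m) f g = begin
    Σ₁ m (λ a → f a + g a) + (f (suc m) + g (suc m))
      ≈⟨ +-congʳ (Σ₁-+ m f g) ⟩
    (Σ₁ m f + Σ₁ m g) + (f (suc m) + g (suc m))
      ≈⟨ solve 4 (λ p q u v → (p :+ q) :+ (u :+ v) := (p :+ u) :+ (q :+ v)) refl _ _ _ _ ⟩
    (Σ₁ m f + f (suc m)) + (Σ₁ m g + g (suc m)) ∎

  Σ₁-shift : ∀ m (f : ℕ → Carrier) → Σ₁ (suc m) f ≈ f 1 + Σ₁ m (λ a → f (suc a))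
  Σ₁-shift zero f = trans (+-identityˡ _) (sym (+-identityʳ _))
  Σ₁-shift (suc m) f = trans (+-congʳ (Σ₁-shift m f)) (+-assoc _ _ _)

  Σ₁²-shift : ∀ m n (f : ℕ → ℕ → Carrier) →
    Σ₁ (suc m) (λ a → Σ₁ (suc n) (f a))
      ≈ Σ₁ (suc n) (f 1) + (Σ₁ m (λ a → f (suc a) 1) + Σ₁ m (λ a → Σ₁ n (λ b → f (suc a) (suc b))))
  Σ₁²-shift m n f = trans (Σ₁-shift m _)
    (+-congˡ (trans (Σ₁-cong m (λ a → Σ₁-shift n (f (suc a)))) (Σ₁-+ m _ _)))

  diagonal : Carrier → Carrier → ℕ → ℕ → Carrier
  diagonal x y zero n = 0#
  diagonal x y (suc m) zero = 0#
  diagonal x y (suc m) (suc n) = binom x m * binom y n + diagonal x y m n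

  diagonal-cong : ∀ {x x′ y y′} m n → x ≈ x′ → y ≈ y′ → diagonal x y m n ≈ diagonal x′ y′ m n
  diagonal-cong zero n x≈x′ y≈y′ = refl
  diagonal-cong (suc m) zero x≈x′ y≈y′ = refl
  diagonal-cong (suc m) (suc n) x≈x′ y≈y′ = +-cong (binom²-cong m n x≈x′ y≈y′) (diagonal-cong m n x≈x′ y≈y′)

  diagonal-zeroʳ : ∀ x y m → diagonal x y m 0 ≈ 0#
  diagonal-zeroʳ x y zero = refl
  diagonal-zeroʳ x y (suc m) = refl

  diagonal-comm : ∀ x y m n → diagonal x y m n ≈ diagonal y x n m
  diagonal-comm x y zero zero = refl
  diagonal-comm x y zero (suc n) = refl
  diagonal-comm x y (suc m) zero = refl
  diagonal-comm x y (suc m) (suc n) = +-cong (*-comm _ _) (diagonal-comm x y m n)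

  diagonal-pascalˡ : ∀ x y m n → diagonal (x + 1#) y (suc m) n ≈ diagonal x y (suc m) n + diagonal x y m n
  diagonal-pascalˡ x y m zero = sym (trans (+-identityˡ _) (diagonal-zeroʳ x y m))
  diagonal-pascalˡ x y zero (suc n) = sym (+-identityʳ _)
  diagonal-pascalˡ x y (suc m) (suc n) = begin
    binom (x + 1#) (suc m) * binom y n + diagonal (x + 1#) y (suc m) n
      ≈⟨ +-cong (*-congʳ (binom-pascal x m)) (diagonal-pascalˡ x y m n) ⟩
    (binom x (suc m) + binom x m) * binom y n + (diagonal x y (suc m) n + diagonal x y m n)
      ≈⟨ solve 5 (λ a b c d e → (a :+ b) :* c :+ (d :+ e) := (a :* c :+ d) :+ (b :* c :+ e))
           refl (binom x (suc m)) (binom x m) (binom y n) (diagonal x y (suc m) n) (diagonal x y m n) ⟩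
    (binom x (suc m) * binom y n + diagonal x y (suc m) n) + (binom x m * binom y n + diagonal x y m n) ∎

  diagonal-pascalʳ : ∀ x y m n → diagonal x (y + 1#) m (suc n) ≈ diagonal x y m (suc n) + diagonal x y m n
  diagonal-pascalʳ x y m n = begin
    diagonal x (y + 1#) m (suc n)              ≈⟨ diagonal-comm x (y + 1#) m (suc n) ⟩
    diagonal (y + 1#) x (suc n) m              ≈⟨ diagonal-pascalˡ y x n m ⟩
    diagonal y x (suc n) m + diagonal y x n m  ≈⟨ +-cong (diagonal-comm y x (suc n) m) (diagonal-comm y x n m) ⟩
    diagonal x y m (suc n) + diagonal x y m n  ∎

  diagonal-transfer : ∀ x y m n →
    diagonal x (y + 1#) (suc m) (suc n) ≈ binom x m * binom y n + diagonal (x + 1#) y (suc m) n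
  diagonal-transfer x y m n = begin
    diagonal x (y + 1#) (suc m) (suc n)
      ≈⟨ diagonal-pascalʳ x y (suc m) n ⟩
    (binom x m * binom y n + diagonal x y m n) + diagonal x y (suc m) n
      ≈⟨ +-assoc _ _ _ ⟩
    binom x m * binom y n + (diagonal x y m n + diagonal x y (suc m) n)
      ≈⟨ +-congˡ (trans (+-comm _ _) (sym (diagonal-pascalˡ x y m n))) ⟩
    binom x m * binom y n + diagonal (x + 1#) y (suc m) n ∎

  Σ₁-binom-convolution : ∀ m N u v →
    Σ₁ N (λ b → binom (u + ⟦ b ⟧ - 1#) m * binom (v - ⟦ b ⟧) (N ∸ b)) ≈ diagonal u v (suc m) N
  Σ₁-binom-convolution m zero u v = refl
  Σ₁-binom-convolution m (suc N) u v = begin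
    Σ₁ (suc N) f
      ≈⟨ Σ₁-shift N f ⟩
    f 1 + Σ₁ N (λ b → f (suc b))
      ≈⟨ +-cong (binom²-cong m N u+1-1≈u v-1≈v-1)
                (Σ₁-cong N λ b → binom²-cong m (N ∸ b) (shiftˡ ⟦ b ⟧) (shiftʳ ⟦ b ⟧)) ⟩
    binom u m * binom (v - 1#) N + Σ₁ N (λ b → binom (u + 1# + ⟦ b ⟧ - 1#) m * binom (v - 1# - ⟦ b ⟧) (N ∸ b))
      ≈⟨ +-congˡ (Σ₁-binom-convolution m N (u + 1#) (v - 1#)) ⟩
    binom u m * binom (v - 1#) N + diagonal (u + 1#) (v - 1#) (suc m) N
      ≈⟨ diagonal-transfer u (v - 1#) m N ⟨
    diagonal u (v - 1# + 1#) (suc m) (suc N)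
      ≈⟨ diagonal-cong (suc m) (suc N) refl (solve 1 (λ v → v :- 𝟙 :+ 𝟙 := v) refl v) ⟩
    diagonal u v (suc m) (suc N) ∎
    where
    f : ℕ → Carrier
    f b = binom (u + ⟦ b ⟧ - 1#) m * binom (v - ⟦ b ⟧) (suc N ∸ b)
    u+1-1≈u : u + ⟦ 1 ⟧ - 1# ≈ u
    u+1-1≈u = solve 1 (λ u → u :+ (𝟘 :+ 𝟙) :- 𝟙 := u) refl u
    v-1≈v-1 : v - ⟦ 1 ⟧ ≈ v - 1#
    v-1≈v-1 = solve 1 (λ v → v :- (𝟘 :+ 𝟙) := v :- 𝟙) refl v
    shiftˡ : ∀ b → u + (b + 1#) - 1# ≈ u + 1# + b - 1#
    shiftˡ = solve 2 (λ u b → u :+ (b :+ 𝟙) :- 𝟙 := u :+ 𝟙 :+ b :- 𝟙) refl u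
    shiftʳ : ∀ b → v - (b + 1#) ≈ v - 1# - b
    shiftʳ = solve 2 (λ v b → v :- (b :+ 𝟙) := v :- 𝟙 :- b) refl v

  term : Carrier → Carrier → ℕ → ℕ → ℕ → ℕ → Carrier
  term x y m n a b = binom (x - ⟦ a ⟧ + ⟦ b ⟧ - 1#) (m ∸ a) * binom (y + ⟦ a ⟧ - ⟦ b ⟧ - 1#) (n ∸ b)

  doubleSum : Carrier → Carrier → ℕ → ℕ → Carrier
  doubleSum x y m n = Σ₁ m (λ a → Σ₁ n (term x y m n a))

  doubleSum-suc : ∀ x y m n → doubleSum x y (suc m) (suc n) ≈ doubleSum x y m n + diagonal x y (suc m) (suc n)
  doubleSum-suc x y m n = begin
    doubleSum x y (suc m) (suc n)
      ≈⟨ Σ₁²-shift m n t ⟩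
    Σ₁ (suc n) (t 1) + (Σ₁ m (λ a → t (suc a) 1) + Σ₁ m (λ a → Σ₁ n (λ b → t (suc a) (suc b))))
      ≈⟨ +-cong firstRow (+-cong firstColumn (Σ₁-cong m λ a → Σ₁-cong n λ b → interior a b)) ⟩
    diagonal (x - 1#) y (suc m) (suc n) + (diagonal (x - 1#) y m (suc n) + doubleSum x y m n)
      ≈⟨ solve 3 (λ d e s → d :+ (e :+ s) := s :+ (d :+ e)) refl _ _ (doubleSum x y m n) ⟩
    doubleSum x y m n + (diagonal (x - 1#) y (suc m) (suc n) + diagonal (x - 1#) y m (suc n))
      ≈⟨ +-congˡ (diagonal-pascalˡ (x - 1#) y m (suc n)) ⟨
    doubleSum x y m n + diagonal (x - 1# + 1#) y (suc m) (suc n)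
      ≈⟨ +-congˡ (diagonal-cong (suc m) (suc n) (solve 1 (λ x → x :- 𝟙 :+ 𝟙 := x) refl x) refl) ⟩
    doubleSum x y m n + diagonal x y (suc m) (suc n) ∎
    where
    t : ℕ → ℕ → Carrier
    t = term x y (suc m) (suc n)
    firstRow : Σ₁ (suc n) (t 1) ≈ diagonal (x - 1#) y (suc m) (suc n)
    firstRow = trans
      (Σ₁-cong (suc n) λ b → binom²-cong m (suc n ∸ b)
        (solve 2 (λ x b → x :- (𝟘 :+ 𝟙) :+ b :- 𝟙 := x :- 𝟙 :+ b :- 𝟙) refl x ⟦ b ⟧)
        (solve 2 (λ y b → y :+ (𝟘 :+ 𝟙) :- b :- 𝟙 := y :- b) refl y ⟦ b ⟧))
      (Σ₁-binom-convolution m (suc n) (x - 1#) y)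
    firstColumn : Σ₁ m (λ a → t (suc a) 1) ≈ diagonal (x - 1#) y m (suc n)
    firstColumn = begin
      Σ₁ m (λ a → t (suc a) 1)
        ≈⟨ Σ₁-cong m (λ a → trans (*-comm _ _) (binom²-cong n (m ∸ a)
             (solve 2 (λ y a → y :+ (a :+ 𝟙) :- (𝟘 :+ 𝟙) :- 𝟙 := y :+ a :- 𝟙) refl y ⟦ a ⟧)
             (solve 2 (λ x a → x :- (a :+ 𝟙) :+ (𝟘 :+ 𝟙) :- 𝟙 := x :- 𝟙 :- a) refl x ⟦ a ⟧))) ⟩
      Σ₁ m (λ a → binom (y + ⟦ a ⟧ - 1#) n * binom (x - 1# - ⟦ a ⟧) (m ∸ a))
        ≈⟨ Σ₁-binom-convolution n m y (x - 1#) ⟩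
      diagonal y (x - 1#) (suc n) m
        ≈⟨ diagonal-comm y (x - 1#) (suc n) m ⟩
      diagonal (x - 1#) y m (suc n) ∎
    interior : ∀ a b → t (suc a) (suc b) ≈ term x y m n a b
    interior a b = binom²-cong (m ∸ a) (n ∸ b)
      (solve 3 (λ x a b → x :- (a :+ 𝟙) :+ (b :+ 𝟙) :- 𝟙 := x :- a :+ b :- 𝟙) refl x ⟦ a ⟧ ⟦ b ⟧)
      (solve 3 (λ y a b → y :+ (a :+ 𝟙) :- (b :+ 𝟙) :- 𝟙 := y :+ a :- b :- 𝟙) refl y ⟦ a ⟧ ⟦ b ⟧)

  doubleSum-identity : ∀ x y m n →
    (x + y) * doubleSum x y m n
      ≈ ⟦ m ⟧ * ⟦ n ⟧ * binom x m * binom y n - (x * y - ⟦ n ⟧ * x - ⟦ m ⟧ * y) * diagonal x y m n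
  doubleSum-identity x y zero n =
    solve 5 (λ x y N a b → (x :+ y) :* 𝟘 := 𝟘 :* N :* a :* b :- (x :* y :- N :* x :- 𝟘 :* y) :* 𝟘)
      refl x y ⟦ n ⟧ (binom x 0) (binom y n)
  doubleSum-identity x y (suc m) zero = begin
    (x + y) * Σ₁ (suc m) (λ _ → 0#)
      ≈⟨ *-congˡ (Σ₁-zero (suc m)) ⟩
    (x + y) * 0#
      ≈⟨ solve 5 (λ x y M a b → (x :+ y) :* 𝟘 := (M :+ 𝟙) :* 𝟘 :* a :* b :- (x :* y :- 𝟘 :* x :- (M :+ 𝟙) :* y) :* 𝟘)
           refl x y ⟦ m ⟧ (binom x (suc m)) (binom y 0) ⟩
    ⟦ suc m ⟧ * ⟦ 0 ⟧ * binom x (suc m) * binom y 0 - (x * y - ⟦ 0 ⟧ * x - ⟦ suc m ⟧ * y) * 0# ∎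
  doubleSum-identity x y (suc m) (suc n) = begin
    (x + y) * doubleSum x y (suc m) (suc n)
      ≈⟨ *-congˡ (doubleSum-suc x y m n) ⟩
    (x + y) * (doubleSum x y m n + (a * b + D))
      ≈⟨ distribˡ _ _ _ ⟩
    (x + y) * doubleSum x y m n + (x + y) * (a * b + D)
      ≈⟨ +-congʳ (doubleSum-identity x y m n) ⟩
    (M * N * a * b - (x * y - N * x - M * y) * D) + (x + y) * (a * b + D)
      ≈⟨ solve 7 (λ x y M N a b D → (M :* N :* a :* b :- (x :* y :- N :* x :- M :* y) :* D) :+ (x :+ y) :* (a :* b :+ D)
                     := (x :- M) :* a :* ((y :- N) :* b) :- (x :* y :- (N :+ 𝟙) :* x :- (M :+ 𝟙) :* y) :* (a :* b :+ D))
           refl x y M N a b D ⟩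
    (x - M) * a * ((y - N) * b) - q * (a * b + D)
      ≈⟨ +-congʳ (*-cong (binom-absorption x m) (binom-absorption y n)) ⟨
    ⟦ suc m ⟧ * binom x (suc m) * (⟦ suc n ⟧ * binom y (suc n)) - q * (a * b + D)
      ≈⟨ +-congʳ (solve 4 (λ p q u v → p :* u :* (q :* v) := p :* q :* u :* v)
                    refl ⟦ suc m ⟧ ⟦ suc n ⟧ (binom x (suc m)) (binom y (suc n))) ⟩
    ⟦ suc m ⟧ * ⟦ suc n ⟧ * binom x (suc m) * binom y (suc n) - q * diagonal x y (suc m) (suc n) ∎
    where
    M = ⟦ m ⟧
    N = ⟦ n ⟧
    a = binom x m
    b = binom y n
    D = diagonal x y m n
    q = x * y - ⟦ suc n ⟧ * x - ⟦ suc m ⟧ * y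

  x+y≈[1+α][M+βN] : ∀ {α β} M N → α * β ≈ 1# →
    let x = (1# + α) * M ; y = (1# + β) * N in x + y ≈ (1# + α) * (M + β * N)
  x+y≈[1+α][M+βN] {α} {β} M N αβ≈1 = begin
    (1# + α) * M + (1# + β) * N
      ≈⟨ solve 4 (λ α β M N → (𝟙 :+ α) :* M :+ (𝟙 :+ β) :* N := (𝟙 :+ α) :* (M :+ β :* N) :+ (𝟙 :- α :* β) :* N)
           refl α β M N ⟩
    (1# + α) * (M + β * N) + (1# - α * β) * N
      ≈⟨ +-congˡ (*-congʳ (+-congˡ (-‿cong αβ≈1))) ⟩
    (1# + α) * (M + β * N) + (1# - 1#) * N
      ≈⟨ solve 2 (λ s N → s :+ (𝟙 :- 𝟙) :* N := s) refl _ N ⟩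
    (1# + α) * (M + β * N) ∎

  xy-Nx-My≈0 : ∀ {α β} M N → α * β ≈ 1# →
    let x = (1# + α) * M ; y = (1# + β) * N in x * y - N * x - M * y ≈ 0#
  xy-Nx-My≈0 {α} {β} M N αβ≈1 = begin
    (1# + α) * M * ((1# + β) * N) - N * ((1# + α) * M) - M * ((1# + β) * N)
      ≈⟨ solve 4 (λ α β M N → (𝟙 :+ α) :* M :* ((𝟙 :+ β) :* N) :- N :* ((𝟙 :+ α) :* M) :- M :* ((𝟙 :+ β) :* N)
                                := (α :* β :- 𝟙) :* (M :* N))
           refl α β M N ⟩
    (α * β - 1#) * (M * N)
      ≈⟨ *-congʳ (+-congʳ αβ≈1) ⟩
    (1# - 1#) * (M * N)
      ≈⟨ solve 1 (λ P → (𝟙 :- 𝟙) :* P := 𝟘) refl (M * N) ⟩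
    0# ∎

theorem1 : ∀ {c ℓ} (F : CharZeroField c ℓ) (m n : ℕ) →
    let open CharZeroField F in
    (α : Carrier) (α≠0 : ¬ (α ≈ 0#)) →
    let α⁻¹ = inv α α≠0
        D = (1# + α) * (⟦ m ⟧ + α⁻¹ * ⟦ n ⟧)
    in (D≠0 : ¬ (D ≈ 0#)) →
    Σ₁ m (λ a → Σ₁ n (λ b →
        binom ((1# + α) * ⟦ m ⟧ - ⟦ a ⟧ + ⟦ b ⟧ - 1#) (m ∸ a)
      * binom ((1# + α⁻¹) * ⟦ n ⟧ + ⟦ a ⟧ - ⟦ b ⟧ - 1#) (n ∸ b)))
    ≈ ⟦ m ℕ.* n ⟧ * inv D D≠0
      * binom ((1# + α) * ⟦ m ⟧) m * binom ((1# + α⁻¹) * ⟦ n ⟧) n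
theorem1 F m n α α≠0 D≠0 = begin
    doubleSum x y m n
      ≈⟨ x*y≈z⇒y≈x⁻¹*z D≠0 D*doubleSum ⟩
    D⁻¹ * (M * N * binom x m * binom y n)
      ≈⟨ solve 5 (λ i M N a b → i :* (M :* N :* a :* b) := M :* N :* i :* a :* b) refl D⁻¹ M N (binom x m) (binom y n) ⟩
    M * N * D⁻¹ * binom x m * binom y n
      ≈⟨ *-congʳ (*-congʳ (*-congʳ (ι-homo-* m n))) ⟨
    ⟦ m ℕ.* n ⟧ * D⁻¹ * binom x m * binom y n ∎
  where
  open CharZeroField F
  open Development F
  open IntegerSolver commutativeRing
  open import Relation.Binary.Reasoning.Setoid setoid
  M = ⟦ m ⟧
  N = ⟦ n ⟧
  x = (1# + α) * M
  y = (1# + inv α α≠0) * N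
  D = (1# + α) * (M + inv α α≠0 * N)
  D⁻¹ = inv D D≠0
  D*doubleSum : D * doubleSum x y m n ≈ M * N * binom x m * binom y n
  D*doubleSum = begin
    D * doubleSum x y m n
      ≈⟨ *-congʳ (x+y≈[1+α][M+βN] M N (inverse α α≠0)) ⟨
    (x + y) * doubleSum x y m n
      ≈⟨ doubleSum-identity x y m n ⟩
    M * N * binom x m * binom y n - (x * y - N * x - M * y) * diagonal x y m n
      ≈⟨ +-congˡ (-‿cong (*-congʳ (xy-Nx-My≈0 M N (inverse α α≠0)))) ⟩
    M * N * binom x m * binom y n - 0# * diagonal x y m n
      ≈⟨ solve 2 (λ P d → P :- 𝟘 :* d := P) refl _ (diagonal x y m n) ⟩
    M * N * binom x m * binom y n ∎
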